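{- For every positive integer $d$, $$v_2\left(\sum_{i=1}^{d}\frac{1}{2i-1}\right)=2v_2(d).$$
   Context: $v_2$ is the $2$-adic valuation on $\mathbb{Q}$. -}

module Defs where

open import Data.Nat using (ℕ; zero; suc; _+_; _*_)
open import Data.Nat.Divisibility using (_∣?_)
open import Data.Integer using (ℤ; +_; _-_; ∣_∣)
open import Data.Rational using (ℚ; 0ℚ; _/_; ↥_; ↧ₙ_)
import Data.Rational as ℚ
open import Relation.Nullary using (yes; no)

-- For n ≥ 1, v2(n) < n, so fuel n suffices; v2ℕ 0 = 0 by convention
-- (never used on 0 in the statement).
v2ℕ-fuel : ℕ → ℕ → ℕ
v2ℕ-fuel zero    n = 0
v2ℕ-fuel (suc f) zero = 0
v2ℕ-fuel (suc f) (suc n) with 2 ∣? suc n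
... | yes _ = suc (v2ℕ-fuel f (Data.Nat._/_ (suc n) 2))
... | no  _ = 0

v2ℕ : ℕ → ℕ
v2ℕ n = v2ℕ-fuel n n

-- 2-adic valuation of a rational number (numerator / denominator in lowest
-- terms): v2(p/q) = v2(|p|) - v2(q).  Value at 0 is 0 by convention.
v2 : ℚ → ℤ
v2 r = + v2ℕ ∣ ↥ r ∣ - + v2ℕ (↧ₙ r)

oddHarmonic : ℕ → ℚ
oddHarmonic zero    = 0ℚ
oddHarmonic (suc d) = oddHarmonic d ℚ.+ ((+ 1) / suc (2 * d))

module Submission where

-- Work in ℤ₍₂₎, the rationals with odd denominator, and write H d = ∑_{i<d} 1/(2i+1),
-- S d = ∑_{i<d} 1/(2i+1)².  Pairing the terms i and d-1-i, whose denominators a, b satisfy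
-- a + b = 2d, and writing 1/a + 1/b = -2d/a² + 4d²/(a²b), gives 2H d = -2d·S d + 4d²·R with R
-- 2-integral.  Shifting an index by e changes 1/(2i+1)² by a multiple of 4e, so splitting
-- S(2e) = S e + ∑_{i<e} 1/(2(e+i)+1)² and inducting shows S d ≡ d (mod 2^{k+1}) whenever 2^k ∣ d.
-- Hence 2H d ≡ -2d² (mod 2^{2k+2}), i.e. H d ≡ -d² (mod 2^{2k+1}); for d = 2^k m with m odd
-- the numerator of H d is therefore 4^k times an odd number, and v₂(H d) = 2k.

open import Defs
open import Data.Nat using (ℕ; suc)
open import Data.Integer using (+_)
open import Relation.Binary.PropositionalEquality using (_≡_)

open import Data.Nat as ℕ using (zero; _∸_)
import Data.Nat.Properties as ℕₚ
open import Data.Nat.Divisibility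
  using (_∣_; divides; _∣?_; _∣0; 1∣_; ∣-trans; m∣m*n; n∣m*n; *-monoʳ-∣; *-cancelˡ-∣)
open import Data.Nat.DivMod using (m*n/n≡m)
open import Data.Nat.Induction using (<-rec)
open import Data.Nat.Coprimality as Coprimality using (Coprime; coprime-divisor) renaming (sym to ⊥-sym)
open import Data.Nat.Primality using (Prime; euclidsLemma; prime[2]; prime⇒nonZero)
open import Data.Product using (∃; ∃₂; _×_; _,_; proj₁; proj₂)
open import Data.Sum using (inj₁; inj₂; [_,_])
open import Relation.Nullary using (¬_; yes; no; contradiction)
open import Relation.Binary.PropositionalEquality using (refl; sym; trans; cong; cong₂; subst; subst₂; module ≡-Reasoning)
open import Relation.Binary.Bundles using (Setoid)
import Relation.Binary.Reasoning.Setoid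
import Data.Integer.Properties as ℤₚ
import Data.Integer.Divisibility.Signed as ℤ∣
open import Data.Integer.Tactic.RingSolver using (solve; solve-∀)
open import Data.Nat.Tactic.RingSolver using () renaming (solve-∀ to ℕ-solve-∀)
open import Data.List using (_∷_; [])
open import Function using (_∘_)
open import Data.Rational as ℚ using (ℚ; mkℚ; ↥_; ↧_; ↧ₙ_)
import Data.Rational.Properties as ℚₚ
open import Data.Integer.GCD using (gcd)

module _ where
  open Data.Nat using (_+_; _*_; _^_; _<_; _/_; s≤s; z≤n)

  p^n∣m*o⇒p^n∣m : ∀ {p} → Prime p → ∀ n {m o} → p ^ n ∣ m * o → ¬ p ∣ o → p ^ n ∣ m
  p^n∣m*o⇒p^n∣m pp zero _ _ = 1∣ _
  p^n∣m*o⇒p^n∣m {p} pp (suc n) {m} {o} p^[1+n]∣m*o p∤o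
    with euclidsLemma m o pp (∣-trans (m∣m*n (p ^ n)) p^[1+n]∣m*o)
  ... | inj₂ p∣o = contradiction p∣o p∤o
  ... | inj₁ (divides q refl) = subst (p ^ suc n ∣_) (ℕₚ.*-comm p q) (*-monoʳ-∣ p p^n∣q)
    where
    instance _ = prime⇒nonZero pp
    q*p*o≡p*[q*o] : q * p * o ≡ p * (q * o)
    q*p*o≡p*[q*o] = trans (cong (_* o) (ℕₚ.*-comm q p)) (ℕₚ.*-assoc p q o)
    p^n∣q : p ^ n ∣ q
    p^n∣q = p^n∣m*o⇒p^n∣m pp n
      (*-cancelˡ-∣ p (subst (p ^ suc n ∣_) q*p*o≡p*[q*o] p^[1+n]∣m*o)) p∤o

  n<2^n : ∀ n → n < 2 ^ n
  n<2^n zero = s≤s z≤n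
  n<2^n (suc n) = ℕₚ.≤-<-trans (n<2^n n) (ℕₚ.^-monoʳ-< 2 (s≤s (s≤s z≤n)) (ℕₚ.n<1+n n))

  2^[1+k]*m≡2^k*m*2 : ∀ k m → 2 ^ suc k * m ≡ 2 ^ k * m * 2
  2^[1+k]*m≡2^k*m*2 k m = trans (ℕₚ.*-assoc 2 (2 ^ k) m) (ℕₚ.*-comm 2 (2 ^ k * m))

  v2ℕ-fuel-2^k*m : ∀ {f} k {m n} → ¬ 2 ∣ m → k < f → n ≡ 2 ^ k * m → v2ℕ-fuel f n ≡ k
  v2ℕ-fuel-2^k*m k {zero} 2∤m _ _ = contradiction (2 ∣0) 2∤m
  v2ℕ-fuel-2^k*m {suc f} k {suc m} {zero} _ _ 0≡2^k*m =
    contradiction (sym 0≡2^k*m) (ℕ.≢-nonZero⁻¹ _ {{ℕₚ.m*n≢0 (2 ^ k) (suc m) {{ℕₚ.m^n≢0 2 k}}}})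
  v2ℕ-fuel-2^k*m {suc f} zero {suc m} {suc n} 2∤m _ n≡m with 2 ∣? suc n
  ... | yes 2∣n = contradiction (subst (2 ∣_) (trans n≡m (ℕₚ.*-identityˡ _)) 2∣n) 2∤m
  ... | no _    = refl
  v2ℕ-fuel-2^k*m {suc f} (suc k) {suc m} {suc n} 2∤m (s≤s k<f) n≡2^[1+k]*m
    with 2 ∣? suc n | trans n≡2^[1+k]*m (2^[1+k]*m≡2^k*m*2 k (suc m))
  ... | no 2∤n | n≡2^k*m*2 = contradiction (divides (2 ^ k * suc m) n≡2^k*m*2) 2∤n
  ... | yes _  | n≡2^k*m*2 =
    cong suc (v2ℕ-fuel-2^k*m k 2∤m k<f (trans (cong (_/ 2) n≡2^k*m*2) (m*n/n≡m (2 ^ k * suc m) 2)))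

  v2ℕ-2^k*m : ∀ k {m} → ¬ 2 ∣ m → v2ℕ (2 ^ k * m) ≡ k
  v2ℕ-2^k*m k {zero} 2∤m = contradiction (2 ∣0) 2∤m
  v2ℕ-2^k*m k {suc m} 2∤m =
    v2ℕ-fuel-2^k*m k 2∤m (ℕₚ.<-≤-trans (n<2^n k) (ℕₚ.m≤m*n (2 ^ k) (suc m))) refl

  suc≡2^k*odd : ∀ n → ∃₂ λ k m → suc n ≡ 2 ^ k * m × ¬ 2 ∣ m
  suc≡2^k*odd = <-rec _ go
    where
    go : ∀ n → (∀ {n′} → n′ < n → ∃₂ λ k m → suc n′ ≡ 2 ^ k * m × ¬ 2 ∣ m) →
         ∃₂ λ k m → suc n ≡ 2 ^ k * m × ¬ 2 ∣ m
    go n rec with 2 ∣? suc n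
    ... | no 2∤n = 0 , suc n , sym (ℕₚ.*-identityˡ (suc n)) , 2∤n
    ... | yes (divides zero ())
    ... | yes (divides (suc q) n≡q*2) with rec q<n
      where
      q<n : q < n
      q<n = ℕₚ.≤-pred (subst (suc q <_) (sym n≡q*2) (ℕₚ.m<m*n (suc q) 2 (s≤s (s≤s z≤n))))
    ...   | k , m , q≡2^k*m , 2∤m =
      suc k , m , trans n≡q*2 (trans (cong (_* 2) q≡2^k*m) (sym (2^[1+k]*m≡2^k*m*2 k m))) , 2∤m

  v2ℕ-reduced-fraction : ∀ {n d j a b} → Coprime n d → n * b ≡ a * 2 ^ j * d → ¬ 2 ∣ b → ¬ 2 ∣ a →
                         v2ℕ n ≡ j × v2ℕ d ≡ 0
  v2ℕ-reduced-fraction {n} {d} {j} {a} {b} n⊥d nb≡a2^jd 2∤b 2∤a =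
    trans (cong v2ℕ n≡2^j*c) (v2ℕ-2^k*m j 2∤c) , trans (cong v2ℕ (sym (ℕₚ.*-identityˡ d))) (v2ℕ-2^k*m 0 2∤d)
    where
    instance _ = ℕₚ.m^n≢0 2 j
    rearrange : ∀ x y z → x * y * z ≡ x * z * y
    rearrange = ℕ-solve-∀
    2∤d : ¬ 2 ∣ d
    2∤d 2∣d = 2∤b (∣-trans 2∣d (coprime-divisor (⊥-sym n⊥d) (divides (a * 2 ^ j) nb≡a2^jd)))
    2^j∣n : 2 ^ j ∣ n
    2^j∣n = p^n∣m*o⇒p^n∣m prime[2] j (divides (a * d) (trans nb≡a2^jd (rearrange a (2 ^ j) d))) 2∤b
    c : ℕ
    c = _∣_.quotient 2^j∣n
    n≡2^j*c : n ≡ 2 ^ j * c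
    n≡2^j*c = trans (_∣_.equality 2^j∣n) (ℕₚ.*-comm c (2 ^ j))
    cb≡ad : c * b ≡ a * d
    cb≡ad = ℕₚ.*-cancelʳ-≡ (c * b) (a * d) (2 ^ j) (begin
      c * b * 2 ^ j   ≡⟨ rearrange c b (2 ^ j) ⟩
      c * 2 ^ j * b   ≡⟨ cong (_* b) (_∣_.equality 2^j∣n) ⟨
      n * b           ≡⟨ nb≡a2^jd ⟩
      a * 2 ^ j * d   ≡⟨ rearrange a (2 ^ j) d ⟩
      a * d * 2 ^ j   ∎)
      where open ≡-Reasoning
    2∤c : ¬ 2 ∣ c
    2∤c 2∣c = [ 2∤a , 2∤d ] (euclidsLemma a d prime[2] (subst (2 ∣_) cb≡ad (∣-trans 2∣c (m∣m*n b))))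

open Data.Integer using (ℤ; -_; _+_; _*_; _-_; ∣_∣)

record Odd (a : ℤ) : Set where
  constructor odd
  field 2∤∣a∣ : ¬ 2 ∣ ∣ a ∣

odd-* : ∀ {a b} → Odd a → Odd b → Odd (a * b)
odd-* {a} {b} (odd 2∤a) (odd 2∤b) = odd λ 2∣ab →
  [ 2∤a , 2∤b ] (euclidsLemma ∣ a ∣ ∣ b ∣ prime[2] (subst (2 ∣_) (ℤₚ.abs-* a b) 2∣ab))

odd-1 : Odd (+ 1)
odd-1 = odd λ { (divides zero ()) ; (divides (suc _) ()) }

odd⇒nonZero : ∀ {a} → Odd a → Data.Integer.NonZero a
odd⇒nonZero {+ zero}                (odd 2∤0) = contradiction (2 ∣0) 2∤0
odd⇒nonZero {+ suc _}               _         = _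
odd⇒nonZero {Data.Integer.-[1+ _ ]} _         = _

infix 4 2^_∣ℤ_

2^_∣ℤ_ : ℕ → ℤ → Set
2^ n ∣ℤ x = + (2 ℕ.^ n) ℤ∣.∣ x

2^∣ℤ-cancel-odd : ∀ n {a b} → 2^ n ∣ℤ a * b → Odd b → 2^ n ∣ℤ a
2^∣ℤ-cancel-odd n {a} {b} 2^n∣ab (odd 2∤b) = ℤ∣.∣ᵤ⇒∣
  (p^n∣m*o⇒p^n∣m prime[2] n (subst (2 ℕ.^ n ∣_) (ℤₚ.abs-* a b) (ℤ∣.∣⇒∣ᵤ 2^n∣ab)) 2∤b)

pos-2^-distrib-+ : ∀ m n → + (2 ℕ.^ (m ℕ.+ n)) ≡ + (2 ℕ.^ m) * + (2 ℕ.^ n)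
pos-2^-distrib-+ m n = trans (cong +_ (ℕₚ.^-distribˡ-+-* 2 m n)) (ℤₚ.pos-* (2 ℕ.^ m) (2 ℕ.^ n))

2^∣ℤ-* : ∀ m n {a b} → 2^ m ∣ℤ a → 2^ n ∣ℤ b → 2^ (m ℕ.+ n) ∣ℤ a * b
2^∣ℤ-* m n {a} {b} 2^m∣a 2^n∣b = subst (λ c → c ℤ∣.∣ a * b) (sym (pos-2^-distrib-+ m n))
  (ℤ∣.∣-trans (ℤ∣.*-monoˡ-∣ (+ (2 ℕ.^ n)) 2^m∣a) (ℤ∣.*-monoʳ-∣ a 2^n∣b))

2^∣ℤ-halve : ∀ n {a} → 2^ suc n ∣ℤ + 2 * a → 2^ n ∣ℤ a
2^∣ℤ-halve n h = ℤ∣.*-cancelˡ-∣ (+ 2) (subst (λ c → c ℤ∣.∣ _) (ℤₚ.pos-* 2 (2 ℕ.^ n)) h)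

record ℤ₍₂₎ : Set where
  constructor mkℤ₍₂₎
  field
    num     : ℤ
    den     : ℤ
    den-odd : Odd den
open ℤ₍₂₎

infixl 7 _·_ _⊗_
infixl 6 _⊕_ _⊖_
infix 4 _≈_

ι : ℤ → ℤ₍₂₎
ι a = mkℤ₍₂₎ a (+ 1) odd-1

recip : ∀ a → Odd a → ℤ₍₂₎
recip a a-odd = mkℤ₍₂₎ (+ 1) a a-odd

_⊕_ : ℤ₍₂₎ → ℤ₍₂₎ → ℤ₍₂₎
x ⊕ y = mkℤ₍₂₎ (num x * den y + num y * den x) (den x * den y) (odd-* (den-odd x) (den-odd y))

_⊖_ : ℤ₍₂₎ → ℤ₍₂₎ → ℤ₍₂₎
x ⊖ y = mkℤ₍₂₎ (num x * den y - num y * den x) (den x * den y) (odd-* (den-odd x) (den-odd y))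

_⊗_ : ℤ₍₂₎ → ℤ₍₂₎ → ℤ₍₂₎
x ⊗ y = mkℤ₍₂₎ (num x * num y) (den x * den y) (odd-* (den-odd x) (den-odd y))

_·_ : ℤ → ℤ₍₂₎ → ℤ₍₂₎
k · x = mkℤ₍₂₎ (k * num x) (den x) (den-odd x)

record _≈_ (x y : ℤ₍₂₎) : Set where
  constructor *≡*
  field cross : num x * den y ≡ num y * den x

≈-refl : ∀ {x} → x ≈ x
≈-refl = *≡* refl

≈-sym : ∀ {x y} → x ≈ y → y ≈ x
≈-sym (*≡* eq) = *≡* (sym eq)

≈-trans : ∀ {x y z} → x ≈ y → y ≈ z → x ≈ z
≈-trans {mkℤ₍₂₎ a b _} {mkℤ₍₂₎ c e e-odd} {mkℤ₍₂₎ f g _} (*≡* ae≡cb) (*≡* cg≡fe) =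
  *≡* (ℤₚ.*-cancelʳ-≡ (a * g) (f * b) e {{odd⇒nonZero e-odd}} (begin
    a * g * e   ≡⟨ solve (a ∷ g ∷ e ∷ []) ⟩
    a * e * g   ≡⟨ cong (_* g) ae≡cb ⟩
    c * b * g   ≡⟨ solve (c ∷ b ∷ g ∷ []) ⟩
    c * g * b   ≡⟨ cong (_* b) cg≡fe ⟩
    f * e * b   ≡⟨ solve (f ∷ e ∷ b ∷ []) ⟩
    f * b * e   ∎))
  where open ≡-Reasoning

≈-setoid : Setoid _ _
≈-setoid = record
  { Carrier       = ℤ₍₂₎
  ; _≈_           = _≈_
  ; isEquivalence = record { refl = ≈-refl ; sym = ≈-sym ; trans = ≈-trans }
  }

⊕-cong : ∀ {x x′ y y′} → x ≈ x′ → y ≈ y′ → x ⊕ y ≈ x′ ⊕ y′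
⊕-cong {mkℤ₍₂₎ a b _} {mkℤ₍₂₎ a′ b′ _} {mkℤ₍₂₎ c e _} {mkℤ₍₂₎ c′ e′ _} (*≡* ab′≡a′b) (*≡* ce′≡c′e) =
  *≡* (begin
    (a * e + c * b) * (b′ * e′)        ≡⟨ solve (a ∷ b ∷ c ∷ e ∷ b′ ∷ e′ ∷ []) ⟩
    a * b′ * e * e′ + c * e′ * b * b′  ≡⟨ cong₂ (λ u v → u * e * e′ + v * b * b′) ab′≡a′b ce′≡c′e ⟩
    a′ * b * e * e′ + c′ * e * b * b′  ≡⟨ solve (a′ ∷ b ∷ c′ ∷ e ∷ b′ ∷ e′ ∷ []) ⟩
    (a′ * e′ + c′ * b′) * (b * e)      ∎)
  where open ≡-Reasoning

⊕-congˡ : ∀ x {y z} → y ≈ z → x ⊕ y ≈ x ⊕ z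
⊕-congˡ x = ⊕-cong (≈-refl {x})

⊕-congʳ : ∀ x {y z} → y ≈ z → y ⊕ x ≈ z ⊕ x
⊕-congʳ x y≈z = ⊕-cong y≈z (≈-refl {x})

⊕-comm : ∀ x y → x ⊕ y ≈ y ⊕ x
⊕-comm (mkℤ₍₂₎ a b _) (mkℤ₍₂₎ c e _) = *≡* (identity a b c e)
  where
  identity : ∀ a b c e → (a * e + c * b) * (e * b) ≡ (c * b + a * e) * (b * e)
  identity = solve-∀

⊕-assoc : ∀ x y z → x ⊕ y ⊕ z ≈ x ⊕ (y ⊕ z)
⊕-assoc (mkℤ₍₂₎ a b _) (mkℤ₍₂₎ c e _) (mkℤ₍₂₎ f g _) = *≡* (identity a b c e f g)
  where
  identity : ∀ a b c e f g →
    ((a * e + c * b) * g + f * (b * e)) * (b * (e * g)) ≡ (a * (e * g) + (c * g + f * e) * b) * (b * e * g)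
  identity = solve-∀

⊕-interchange : ∀ x y z w → (x ⊕ y) ⊕ (z ⊕ w) ≈ (x ⊕ z) ⊕ (y ⊕ w)
⊕-interchange (mkℤ₍₂₎ a b _) (mkℤ₍₂₎ c e _) (mkℤ₍₂₎ f g _) (mkℤ₍₂₎ h i _) = *≡* (identity a b c e f g h i)
  where
  identity : ∀ a b c e f g h i →
    ((a * e + c * b) * (g * i) + (f * i + h * g) * (b * e)) * ((b * g) * (e * i)) ≡
    ((a * g + f * b) * (e * i) + (c * i + h * e) * (b * g)) * ((b * e) * (g * i))
  identity = solve-∀

⊕-identityˡ : ∀ x → ι (+ 0) ⊕ x ≈ x
⊕-identityˡ (mkℤ₍₂₎ a b _) = *≡* (identity a b)
  where
  identity : ∀ a b → (+ 0 * b + a * + 1) * b ≡ a * (+ 1 * b)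
  identity = solve-∀

⊕-identityʳ : ∀ x → x ⊕ ι (+ 0) ≈ x
⊕-identityʳ (mkℤ₍₂₎ a b _) = *≡* (identity a b)
  where
  identity : ∀ a b → (a * + 1 + + 0 * b) * b ≡ a * (b * + 1)
  identity = solve-∀

·-distribˡ-⊕ : ∀ k x y → k · (x ⊕ y) ≈ k · x ⊕ k · y
·-distribˡ-⊕ k (mkℤ₍₂₎ a b _) (mkℤ₍₂₎ c e _) = *≡* (identity k a b c e)
  where
  identity : ∀ k a b c e → k * (a * e + c * b) * (b * e) ≡ (k * a * e + k * c * b) * (b * e)
  identity = solve-∀

·-zeroʳ : ∀ k → k · ι (+ 0) ≈ ι (+ 0)
·-zeroʳ k = *≡* (identity k)
  where
  identity : ∀ k → k * + 0 * + 1 ≡ + 0 * + 1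
  identity = solve-∀

x⊕x≈2·x : ∀ x → x ⊕ x ≈ + 2 · x
x⊕x≈2·x (mkℤ₍₂₎ a b _) = *≡* (identity a b)
  where
  identity : ∀ a b → (a * b + a * b) * b ≡ + 2 * a * (b * b)
  identity = solve-∀

·-distribˡ-⊖ : ∀ k x y → k · x ⊖ k · y ≈ k · (x ⊖ y)
·-distribˡ-⊖ k (mkℤ₍₂₎ a b _) (mkℤ₍₂₎ c e _) = *≡* (identity k a b c e)
  where
  identity : ∀ k a b c e → (k * a * e - k * c * b) * (b * e) ≡ k * (a * e - c * b) * (b * e)
  identity = solve-∀

⊖-telescope : ∀ x y z → x ⊖ z ≈ (x ⊖ y) ⊕ (y ⊖ z)
⊖-telescope (mkℤ₍₂₎ a b _) (mkℤ₍₂₎ c e _) (mkℤ₍₂₎ f g _) = *≡* (identity a b c e f g)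
  where
  identity : ∀ a b c e f g →
    (a * g - f * b) * ((b * e) * (e * g)) ≡ ((a * e - c * b) * (e * g) + (c * g - f * e) * (b * e)) * (b * g)
  identity = solve-∀

⊕-⊖-interchange : ∀ x x′ y y′ → (x ⊕ x′) ⊖ (y ⊕ y′) ≈ (x ⊖ y) ⊕ (x′ ⊖ y′)
⊕-⊖-interchange (mkℤ₍₂₎ a b _) (mkℤ₍₂₎ a′ b′ _) (mkℤ₍₂₎ c e _) (mkℤ₍₂₎ c′ e′ _) =
  *≡* (identity a b a′ b′ c e c′ e′)
  where
  identity : ∀ a b a′ b′ c e c′ e′ →
    ((a * b′ + a′ * b) * (e * e′) - (c * e′ + c′ * e) * (b * b′)) * ((b * e) * (b′ * e′)) ≡
    ((a * e - c * b) * (b′ * e′) + (a′ * e′ - c′ * b′) * (b * e)) * ((b * b′) * (e * e′))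
  identity = solve-∀

⊖-ι-zero : ∀ x → x ⊖ ι (+ 0) ≈ x
⊖-ι-zero (mkℤ₍₂₎ a b _) = *≡* (identity a b)
  where
  identity : ∀ a b → (a * + 1 - + 0 * b) * b ≡ a * (b * + 1)
  identity = solve-∀

module ≈-Reasoning = Relation.Binary.Reasoning.Setoid ≈-setoid

∑ : ℕ → (ℕ → ℤ₍₂₎) → ℤ₍₂₎
∑ zero    f = ι (+ 0)
∑ (suc n) f = ∑ n f ⊕ f n

∑-cong : ∀ n {f h} → (∀ {i} → i ℕ.< n → f i ≈ h i) → ∑ n f ≈ ∑ n h
∑-cong zero    f≈h = ≈-refl
∑-cong (suc n) f≈h = ⊕-cong (∑-cong n (λ i<n → f≈h (ℕₚ.m<n⇒m<1+n i<n))) (f≈h (ℕₚ.n<1+n n))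

∑-distrib-⊕ : ∀ n f h → ∑ n (λ i → f i ⊕ h i) ≈ ∑ n f ⊕ ∑ n h
∑-distrib-⊕ zero    f h = ≈-sym (⊕-identityˡ (ι (+ 0)))
∑-distrib-⊕ (suc n) f h = begin
  ∑ n (λ i → f i ⊕ h i) ⊕ (f n ⊕ h n) ≈⟨ ⊕-congʳ (f n ⊕ h n) (∑-distrib-⊕ n f h) ⟩
  (∑ n f ⊕ ∑ n h) ⊕ (f n ⊕ h n)       ≈⟨ ⊕-interchange (∑ n f) (∑ n h) (f n) (h n) ⟩
  (∑ n f ⊕ f n) ⊕ (∑ n h ⊕ h n)       ∎
  where open ≈-Reasoning

∑-distrib-· : ∀ n k f → ∑ n (λ i → k · f i) ≈ k · ∑ n f
∑-distrib-· zero    k f = ≈-sym (·-zeroʳ k)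
∑-distrib-· (suc n) k f = begin
  ∑ n (λ i → k · f i) ⊕ k · f n ≈⟨ ⊕-congʳ (k · f n) (∑-distrib-· n k f) ⟩
  k · ∑ n f ⊕ k · f n           ≈⟨ ·-distribˡ-⊕ k (∑ n f) (f n) ⟨
  k · (∑ n f ⊕ f n)             ∎
  where open ≈-Reasoning

∑-split : ∀ m n f → ∑ (m ℕ.+ n) f ≈ ∑ m f ⊕ ∑ n (λ i → f (m ℕ.+ i))
∑-split m zero    f rewrite ℕₚ.+-identityʳ m = ≈-sym (⊕-identityʳ (∑ m f))
∑-split m (suc n) f rewrite ℕₚ.+-suc m n = begin
  ∑ (m ℕ.+ n) f ⊕ f (m ℕ.+ n)                          ≈⟨ ⊕-congʳ (f (m ℕ.+ n)) (∑-split m n f) ⟩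
  ∑ m f ⊕ ∑ n (λ i → f (m ℕ.+ i)) ⊕ f (m ℕ.+ n)        ≈⟨ ⊕-assoc (∑ m f) (∑ n (λ i → f (m ℕ.+ i))) (f (m ℕ.+ n)) ⟩
  ∑ m f ⊕ (∑ n (λ i → f (m ℕ.+ i)) ⊕ f (m ℕ.+ n))      ∎
  where open ≈-Reasoning

∑-reverse : ∀ n f → ∑ n f ≈ ∑ n (λ i → f (n ∸ suc i))
∑-reverse zero    f = ≈-refl
∑-reverse (suc n) f = begin
  ∑ n f ⊕ f n                            ≈⟨ ⊕-comm (∑ n f) (f n) ⟩
  f n ⊕ ∑ n f                            ≈⟨ ⊕-congˡ (f n) (∑-reverse n f) ⟩
  f n ⊕ ∑ n (λ i → f (n ∸ suc i))        ≈⟨ ⊕-congʳ (∑ n (λ i → f (n ∸ suc i))) (⊕-identityˡ (f n)) ⟨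
  ∑ 1 (λ i → f (n ∸ i)) ⊕ ∑ n (λ i → f (n ∸ suc i)) ≈⟨ ∑-split 1 n (λ i → f (n ∸ i)) ⟨
  ∑ (suc n) (λ i → f (n ∸ i))            ∎
  where open ≈-Reasoning

2^∣ℤ-num-resp-≈ : ∀ n {x y} → x ≈ y → 2^ n ∣ℤ num x → 2^ n ∣ℤ num y
2^∣ℤ-num-resp-≈ n {x} {y} (*≡* xy≡yx) 2^n∣x =
  2^∣ℤ-cancel-odd n (subst (2^ n ∣ℤ_) xy≡yx (ℤ∣.∣m⇒∣m*n (den y) 2^n∣x)) (den-odd x)

2^∣ℤ-num-⊕ : ∀ n x y → 2^ n ∣ℤ num x → 2^ n ∣ℤ num y → 2^ n ∣ℤ num (x ⊕ y)
2^∣ℤ-num-⊕ n x y 2^n∣x 2^n∣y = ℤ∣.∣m∣n⇒∣m+n (ℤ∣.∣m⇒∣m*n (den y) 2^n∣x) (ℤ∣.∣m⇒∣m*n (den x) 2^n∣y)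

-- Since denominators are odd, this is congruence modulo the ideal 2ⁿℤ₍₂₎.
infix 4 _≡_[mod2^_]

record _≡_[mod2^_] (x y : ℤ₍₂₎) (n : ℕ) : Set where
  constructor 2^∣ℤ⇒≡
  field 2^n∣num[x⊖y] : 2^ n ∣ℤ num (x ⊖ y)

≈⇒≡[mod2^] : ∀ n {x y} → x ≈ y → x ≡ y [mod2^ n ]
≈⇒≡[mod2^] n {x} {y} (*≡* xy≡yx) = 2^∣ℤ⇒≡ (ℤ∣.divides (+ 0) (begin
  num x * den y - num y * den x ≡⟨ cong (_- num y * den x) xy≡yx ⟩
  num y * den x - num y * den x ≡⟨ ℤₚ.+-inverseʳ (num y * den x) ⟩
  + 0                           ≡⟨ ℤₚ.*-zeroˡ (+ (2 ℕ.^ n)) ⟨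
  + 0 * + (2 ℕ.^ n)             ∎))
  where open ≡-Reasoning

≡[mod2^]-sym : ∀ n {x y} → x ≡ y [mod2^ n ] → y ≡ x [mod2^ n ]
≡[mod2^]-sym n {x} {y} (2^∣ℤ⇒≡ x≡y) =
  2^∣ℤ⇒≡ (subst (2^ n ∣ℤ_) (identity (num x * den y) (num y * den x)) (ℤ∣.∣m⇒∣-m x≡y))
  where
  identity : ∀ a b → - (a - b) ≡ b - a
  identity = solve-∀

≡[mod2^]-trans : ∀ n {x y z} → x ≡ y [mod2^ n ] → y ≡ z [mod2^ n ] → x ≡ z [mod2^ n ]
≡[mod2^]-trans n {x} {y} {z} (2^∣ℤ⇒≡ x≡y) (2^∣ℤ⇒≡ y≡z) =
  2^∣ℤ⇒≡ (2^∣ℤ-num-resp-≈ n (≈-sym (⊖-telescope x y z)) (2^∣ℤ-num-⊕ n (x ⊖ y) (y ⊖ z) x≡y y≡z))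

≡[mod2^]-setoid : ℕ → Setoid _ _
≡[mod2^]-setoid n = record
  { Carrier       = ℤ₍₂₎
  ; _≈_           = _≡_[mod2^ n ]
  ; isEquivalence = record
    { refl  = ≈⇒≡[mod2^] n ≈-refl
    ; sym   = ≡[mod2^]-sym n
    ; trans = ≡[mod2^]-trans n
    }
  }

module ≡[mod2^]-Reasoning n = Relation.Binary.Reasoning.Setoid (≡[mod2^]-setoid n)

⊕-cong-[mod2^] : ∀ n {x x′ y y′} → x ≡ x′ [mod2^ n ] → y ≡ y′ [mod2^ n ] → x ⊕ y ≡ x′ ⊕ y′ [mod2^ n ]
⊕-cong-[mod2^] n {x} {x′} {y} {y′} (2^∣ℤ⇒≡ x≡x′) (2^∣ℤ⇒≡ y≡y′) =
  2^∣ℤ⇒≡ (2^∣ℤ-num-resp-≈ n (≈-sym (⊕-⊖-interchange x y x′ y′)) (2^∣ℤ-num-⊕ n (x ⊖ x′) (y ⊖ y′) x≡x′ y≡y′))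

⊕-congˡ-[mod2^] : ∀ n x {y z} → y ≡ z [mod2^ n ] → x ⊕ y ≡ x ⊕ z [mod2^ n ]
⊕-congˡ-[mod2^] n x = ⊕-cong-[mod2^] n (≈⇒≡[mod2^] n (≈-refl {x}))

·-cong-[mod2^] : ∀ j n k {x y} → 2^ j ∣ℤ k → x ≡ y [mod2^ n ] → k · x ≡ k · y [mod2^ j ℕ.+ n ]
·-cong-[mod2^] j n k {x} {y} 2^j∣k (2^∣ℤ⇒≡ x≡y) =
  2^∣ℤ⇒≡ (2^∣ℤ-num-resp-≈ (j ℕ.+ n) (≈-sym (·-distribˡ-⊖ k x y)) (2^∣ℤ-* j n 2^j∣k x≡y))

·-≡-0-[mod2^] : ∀ j k x → 2^ j ∣ℤ k → k · x ≡ ι (+ 0) [mod2^ j ]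
·-≡-0-[mod2^] j k x 2^j∣k =
  2^∣ℤ⇒≡ (2^∣ℤ-num-resp-≈ j (≈-sym (⊖-ι-zero (k · x))) (ℤ∣.∣m⇒∣m*n (num x) 2^j∣k))

2·-cancel-[mod2^] : ∀ n {x y} → + 2 · x ≡ + 2 · y [mod2^ suc n ] → x ≡ y [mod2^ n ]
2·-cancel-[mod2^] n {x} {y} (2^∣ℤ⇒≡ 2x≡2y) =
  2^∣ℤ⇒≡ (2^∣ℤ-halve n (2^∣ℤ-num-resp-≈ (suc n) (·-distribˡ-⊖ (+ 2) x y) 2x≡2y))

∑-cong-[mod2^] : ∀ n m {f h} → (∀ {i} → i ℕ.< m → f i ≡ h i [mod2^ n ]) → ∑ m f ≡ ∑ m h [mod2^ n ]
∑-cong-[mod2^] n zero    f≡h = ≈⇒≡[mod2^] n ≈-refl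
∑-cong-[mod2^] n (suc m) f≡h =
  ⊕-cong-[mod2^] n (∑-cong-[mod2^] n m (λ i<m → f≡h (ℕₚ.m<n⇒m<1+n i<m))) (f≡h (ℕₚ.n<1+n m))

ι-⊕ : ∀ a b → ι a ⊕ ι b ≈ ι (a + b)
ι-⊕ a b = *≡* (identity a b)
  where
  identity : ∀ a b → (a * + 1 + b * + 1) * + 1 ≡ (a + b) * (+ 1 * + 1)
  identity = solve-∀

-- s/(ab) = s(s - b)/(a²b): both terms then carry a visible factor of s.
recip-⊕ : ∀ a b a-odd b-odd → let s = a + b; 1/a = recip a a-odd in
          1/a ⊕ recip b b-odd ≈ (- s) · (1/a ⊗ 1/a) ⊕ (s * s) · (1/a ⊗ 1/a ⊗ recip b b-odd)
recip-⊕ a b _ _ = *≡* (identity a b)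
  where
  identity : ∀ a b →
    (+ 1 * b + + 1 * a) * ((a * a) * ((a * a) * b)) ≡
    ((- (a + b) * (+ 1 * + 1)) * ((a * a) * b) + ((a + b) * (a + b) * ((+ 1 * + 1) * + 1)) * (a * a)) * (a * b)
  identity = solve-∀

2*_+1 : ℕ → ℤ
2* i +1 = + 1 + + 2 * + i

2*i+1≡+[1+2*i] : ∀ i → 2* i +1 ≡ + suc (2 ℕ.* i)
2*i+1≡+[1+2*i] i = cong (_+_ (+ 1)) (sym (ℤₚ.pos-* 2 i))

2*i+1-odd : ∀ i → Odd (2* i +1)
2*i+1-odd i = odd λ { (divides q 2i+1≡q*2) →
  ℕₚ.even≢odd q i (trans (ℕₚ.*-comm 2 q) (sym (trans (sym (cong ∣_∣ (2*i+1≡+[1+2*i] i))) 2i+1≡q*2))) }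

oddRecip : ℕ → ℤ₍₂₎
oddRecip i = recip (2* i +1) (2*i+1-odd i)

oddRecipSq : ℕ → ℤ₍₂₎
oddRecipSq i = oddRecip i ⊗ oddRecip i

oddHarmonic′ : ℕ → ℤ₍₂₎
oddHarmonic′ n = ∑ n oddRecip

oddHarmonicSq : ℕ → ℤ₍₂₎
oddHarmonicSq n = ∑ n oddRecipSq

oddRecipSq≡1 : ∀ i → oddRecipSq i ≡ ι (+ 1) [mod2^ 1 ]
oddRecipSq≡1 i = 2^∣ℤ⇒≡ (ℤ∣.divides (- (+ 2 * + i + + 2 * + i * + i)) (identity (+ i)))
  where
  identity : ∀ x → + 1 * + 1 * + 1 - + 1 * ((+ 1 + + 2 * x) * (+ 1 + + 2 * x)) ≡ - (+ 2 * x + + 2 * x * x) * + 2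
  identity = solve-∀

oddRecipSq-shift : ∀ k e i → 2^ k ∣ℤ + e → oddRecipSq (e ℕ.+ i) ≡ oddRecipSq i [mod2^ 2 ℕ.+ k ]
oddRecipSq-shift k e i 2^k∣e = 2^∣ℤ⇒≡ (subst (2^ 2 ℕ.+ k ∣ℤ_) (sym (identity (+ e) (+ i)))
  (ℤ∣.∣m⇒∣m*n (- (2* i +1 + + e)) (2^∣ℤ-* 2 k (ℤ∣.divides (+ 1) refl) 2^k∣e)))
  where
  identity : ∀ y x →
    + 1 * + 1 * ((+ 1 + + 2 * x) * (+ 1 + + 2 * x)) - + 1 * + 1 * ((+ 1 + + 2 * (y + x)) * (+ 1 + + 2 * (y + x))) ≡
    + 4 * y * - ((+ 1 + + 2 * x) + y)
  identity = solve-∀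

oddHarmonicSq≡n : ∀ n → oddHarmonicSq n ≡ ι (+ n) [mod2^ 1 ]
oddHarmonicSq≡n zero    = ≈⇒≡[mod2^] 1 ≈-refl
oddHarmonicSq≡n (suc n) = begin
  oddHarmonicSq n ⊕ oddRecipSq n ≈⟨ ⊕-cong-[mod2^] 1 (oddHarmonicSq≡n n) (oddRecipSq≡1 n) ⟩
  ι (+ n) ⊕ ι (+ 1)              ≈⟨ ≈⇒≡[mod2^] 1 (ι-⊕ (+ n) (+ 1)) ⟩
  ι (+ (n ℕ.+ 1))                ≡⟨ cong (ι ∘ +_) (ℕₚ.+-comm n 1) ⟩
  ι (+ suc n)                    ∎
  where open ≡[mod2^]-Reasoning 1

oddHarmonicSq≡n-[mod2^] : ∀ k {d} → 2 ℕ.^ k ∣ d → oddHarmonicSq d ≡ ι (+ d) [mod2^ suc k ]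
oddHarmonicSq≡n-[mod2^] zero    _ = oddHarmonicSq≡n _
oddHarmonicSq≡n-[mod2^] (suc k) (divides q refl) =
  subst (λ d → oddHarmonicSq d ≡ ι (+ d) [mod2^ 2 ℕ.+ k ]) (sym d≡e+e) (begin
  oddHarmonicSq (e ℕ.+ e)                         ≈⟨ ≈⇒≡[mod2^] _ (∑-split e e oddRecipSq) ⟩
  oddHarmonicSq e ⊕ ∑ e (oddRecipSq ∘ (e ℕ.+_))   ≈⟨ ⊕-congˡ-[mod2^] _ (oddHarmonicSq e)
                                                       (∑-cong-[mod2^] _ e (λ {i} _ → oddRecipSq-shift k e i 2^k∣e)) ⟩
  oddHarmonicSq e ⊕ oddHarmonicSq e               ≈⟨ ≈⇒≡[mod2^] _ (x⊕x≈2·x (oddHarmonicSq e)) ⟩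
  + 2 · oddHarmonicSq e                           ≈⟨ ·-cong-[mod2^] 1 (suc k) (+ 2) (ℤ∣.divides (+ 1) refl)
                                                       (oddHarmonicSq≡n-[mod2^] k (n∣m*n q)) ⟩
  + 2 · ι (+ e)                                   ≡⟨ cong ι (2*e≡e+e) ⟩
  ι (+ (e ℕ.+ e))                                 ∎)
  where
  open ≡[mod2^]-Reasoning (2 ℕ.+ k)
  e : ℕ
  e = q ℕ.* 2 ℕ.^ k
  d≡e+e : q ℕ.* 2 ℕ.^ suc k ≡ e ℕ.+ e
  d≡e+e = q*[2*p]≡q*p+q*p q (2 ℕ.^ k)
    where
    q*[2*p]≡q*p+q*p : ∀ q p → q ℕ.* (2 ℕ.* p) ≡ q ℕ.* p ℕ.+ q ℕ.* p
    q*[2*p]≡q*p+q*p = ℕ-solve-∀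
  2^k∣e : 2^ k ∣ℤ + e
  2^k∣e = ℤ∣.∣ᵤ⇒∣ (n∣m*n q)
  2*e≡e+e : + 2 * + e ≡ + (e ℕ.+ e)
  2*e≡e+e = trans (sym (ℤₚ.pos-* 2 e)) (cong (+_ ∘ (e ℕ.+_)) (ℕₚ.+-identityʳ e))

oddHarmonic′-pairing : ∀ d → let D = + d in
  + 2 · oddHarmonic′ d ≈
  (- (+ 2 * D)) · oddHarmonicSq d ⊕ ((+ 2 * D) * (+ 2 * D)) · ∑ d (λ i → oddRecipSq i ⊗ oddRecip (d ∸ suc i))
oddHarmonic′-pairing d = begin
  + 2 · oddHarmonic′ d                                  ≈⟨ x⊕x≈2·x (oddHarmonic′ d) ⟨
  oddHarmonic′ d ⊕ oddHarmonic′ d                       ≈⟨ ⊕-congˡ (oddHarmonic′ d) (∑-reverse d oddRecip) ⟩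
  oddHarmonic′ d ⊕ ∑ d (λ i → oddRecip (d ∸ suc i))     ≈⟨ ∑-distrib-⊕ d oddRecip (λ i → oddRecip (d ∸ suc i)) ⟨
  ∑ d (λ i → oddRecip i ⊕ oddRecip (d ∸ suc i))         ≈⟨ ∑-cong d pair ⟩
  ∑ d (λ i → c · oddRecipSq i ⊕ c′ · r i)               ≈⟨ ∑-distrib-⊕ d (λ i → c · oddRecipSq i) (λ i → c′ · r i) ⟩
  ∑ d (λ i → c · oddRecipSq i) ⊕ ∑ d (λ i → c′ · r i)   ≈⟨ ⊕-cong (∑-distrib-· d c oddRecipSq) (∑-distrib-· d c′ r) ⟩
  c · oddHarmonicSq d ⊕ c′ · ∑ d r                      ∎
  where
  open ≈-Reasoning
  c c′ : ℤ
  c  = - (+ 2 * + d)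
  c′ = (+ 2 * + d) * (+ 2 * + d)
  r : ℕ → ℤ₍₂₎
  r i = oddRecipSq i ⊗ oddRecip (d ∸ suc i)
  pair : ∀ {i} → i ℕ.< d → oddRecip i ⊕ oddRecip (d ∸ suc i) ≈ c · oddRecipSq i ⊕ c′ · r i
  pair {i} i<d = subst (λ s → oddRecip i ⊕ oddRecip j ≈ (- s) · oddRecipSq i ⊕ (s * s) · r i) s≡2d
    (recip-⊕ (2* i +1) (2* j +1) (2*i+1-odd i) (2*i+1-odd j))
    where
    j = d ∸ suc i
    identity : ∀ x y → (+ 1 + + 2 * x) + (+ 1 + + 2 * y) ≡ + 2 * (+ 1 + (x + y))
    identity = solve-∀
    s≡2d : 2* i +1 + 2* j +1 ≡ + 2 * + d
    s≡2d = trans (identity (+ i) (+ j)) (cong (λ n → + 2 * + n) (ℕₚ.m+[n∸m]≡n i<d))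

oddHarmonic′≡-d² : ∀ k {d} → 2 ℕ.^ k ∣ d → oddHarmonic′ d ≡ ι (- (+ d * + d)) [mod2^ k ℕ.+ suc k ]
oddHarmonic′≡-d² k {d} 2^k∣d = 2·-cancel-[mod2^] (k ℕ.+ suc k) (begin
  + 2 · oddHarmonic′ d                 ≈⟨ ≈⇒≡[mod2^] _ (oddHarmonic′-pairing d) ⟩
  c · oddHarmonicSq d ⊕ c′ · R         ≈⟨ ⊕-cong-[mod2^] _
                                            (·-cong-[mod2^] (suc k) (suc k) c 2^[1+k]∣c (oddHarmonicSq≡n-[mod2^] k 2^k∣d))
                                            (·-≡-0-[mod2^] _ c′ R (2^∣ℤ-* (suc k) (suc k) 2^[1+k]∣2d 2^[1+k]∣2d)) ⟩
  c · ι (+ d) ⊕ ι (+ 0)                ≈⟨ ≈⇒≡[mod2^] _ (*≡* (identity (+ d))) ⟩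
  + 2 · ι (- (+ d * + d))              ∎)
  where
  open ≡[mod2^]-Reasoning (suc k ℕ.+ suc k)
  c c′ : ℤ
  c  = - (+ 2 * + d)
  c′ = (+ 2 * + d) * (+ 2 * + d)
  R : ℤ₍₂₎
  R = ∑ d (λ i → oddRecipSq i ⊗ oddRecip (d ∸ suc i))
  2^[1+k]∣2d : 2^ suc k ∣ℤ + 2 * + d
  2^[1+k]∣2d = 2^∣ℤ-* 1 k (ℤ∣.divides (+ 1) refl) (ℤ∣.∣ᵤ⇒∣ 2^k∣d)
  2^[1+k]∣c : 2^ suc k ∣ℤ c
  2^[1+k]∣c = ℤ∣.∣m⇒∣-m 2^[1+k]∣2d
  identity : ∀ D → (- (+ 2 * D) * D * + 1 + + 0 * + 1) * + 1 ≡ + 2 * - (D * D) * (+ 1 * + 1)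
  identity = solve-∀

odd-+-even : ∀ q {b} → Odd b → Odd (b + + 2 * q)
odd-+-even q {b} (odd 2∤b) = odd λ 2∣b+2q → 2∤b (ℤ∣.∣⇒∣ᵤ {+ 2} {b}
  (ℤ∣.∣m+n∣n⇒∣m (ℤ∣.∣ᵤ⇒∣ {+ 2} {b + + 2 * q} 2∣b+2q) (ℤ∣.divides q (ℤₚ.*-comm (+ 2) q))))

num-≡-odd*2^ : ∀ j x c → x ≡ ι (c * + (2 ℕ.^ j)) [mod2^ suc j ] → Odd c →
               ∃ λ a → num x ≡ a * + (2 ℕ.^ j) × Odd a
num-≡-odd*2^ j x c (2^∣ℤ⇒≡ (ℤ∣.divides q x≡c2^j)) c-odd =
  c * den x + + 2 * q , num-x≡ , odd-+-even q (odd-* c-odd (den-odd x))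
  where
  open ≡-Reasoning
  P : ℤ
  P = + (2 ℕ.^ j)
  identity₁ : ∀ a b → a ≡ (a * + 1 - b) + b
  identity₁ = solve-∀
  identity₂ : ∀ q P c δ → q * (+ 2 * P) + c * P * δ ≡ (c * δ + + 2 * q) * P
  identity₂ = solve-∀
  num-x≡ : num x ≡ (c * den x + + 2 * q) * P
  num-x≡ = begin
    num x                                          ≡⟨ identity₁ (num x) (c * P * den x) ⟩
    (num x * + 1 - c * P * den x) + c * P * den x  ≡⟨ cong (_+ c * P * den x) x≡c2^j ⟩
    q * + (2 ℕ.^ suc j) + c * P * den x            ≡⟨ cong (λ z → q * z + c * P * den x) (ℤₚ.pos-* 2 (2 ℕ.^ j)) ⟩
    q * (+ 2 * P) + c * P * den x                  ≡⟨ identity₂ q P c (den x) ⟩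
    (c * den x + + 2 * q) * P                      ∎

cross-multiply : ∀ {a b g x y} → a * g ≡ x → b * g ≡ y → a * y ≡ x * b
cross-multiply {a} {b} {g} {x} {y} ag≡x bg≡y = begin
  a * y       ≡⟨ cong (a *_) bg≡y ⟨
  a * (b * g) ≡⟨ solve (a ∷ b ∷ g ∷ []) ⟩
  a * g * b   ≡⟨ cong (_* b) ag≡x ⟩
  x * b       ∎
  where open ≡-Reasoning

infix 4 _≃_

record _≃_ (r : ℚ) (x : ℤ₍₂₎) : Set where
  constructor *≡*
  field cross : ↥ r * den x ≡ num x * ↧ r

↥/↧-cross : ∀ i n .{{_ : ℕ.NonZero n}} → ↥ (i ℚ./ n) * + n ≡ i * ↧ (i ℚ./ n)
↥/↧-cross i n = cross-multiply {↥ (i ℚ./ n)} {↧ (i ℚ./ n)} {gcd i (+ n)} {i} {+ n} (ℚₚ.↥-/ i n) (ℚₚ.↧-/ i n)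

≃-+ : ∀ {p q x y} → p ≃ x → q ≃ y → p ℚ.+ q ≃ x ⊕ y
≃-+ {p@record{}} {q@record{}} {x} {y} (*≡* p≃x) (*≡* q≃y) = *≡* (ℤₚ.*-cancelʳ-≡ _ _ (↧ p * ↧ q)
  (algebra (↥ (p ℚ.+ q)) (↧ (p ℚ.+ q)) (↥ p) (↧ p) (↥ q) (↧ q) (num x) (den x) (num y) (den y) p≃x q≃y
    (cross-multiply {↥ (p ℚ.+ q)} {↧ (p ℚ.+ q)} {gcd (↥ p * ↧ q + ↥ q * ↧ p) (↧ p * ↧ q)}
                    {↥ p * ↧ q + ↥ q * ↧ p} {↧ p * ↧ q} (ℚₚ.↥-+ p q) (ℚₚ.↧-+ p q))))
  where
  algebra : ∀ A B a b c e nx dx ny dy → a * dx ≡ nx * b → c * dy ≡ ny * e →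
            A * (b * e) ≡ (a * e + c * b) * B → A * (dx * dy) * (b * e) ≡ (nx * dy + ny * dx) * B * (b * e)
  algebra A B a b c e nx dx ny dy adx≡nxb cdy≡nye A[be]≡ = begin
    A * (dx * dy) * (b * e)                ≡⟨ solve (A ∷ b ∷ e ∷ dx ∷ dy ∷ []) ⟩
    A * (b * e) * dx * dy                  ≡⟨ cong (λ z → z * dx * dy) A[be]≡ ⟩
    (a * e + c * b) * B * dx * dy          ≡⟨ solve (a ∷ b ∷ c ∷ e ∷ B ∷ dx ∷ dy ∷ []) ⟩
    (a * dx * e * dy + c * dy * b * dx) * B ≡⟨ cong₂ (λ u v → (u * e * dy + v * b * dx) * B) adx≡nxb cdy≡nye ⟩
    (nx * b * e * dy + ny * e * b * dx) * B ≡⟨ solve (nx ∷ ny ∷ b ∷ e ∷ B ∷ dx ∷ dy ∷ []) ⟩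
    (nx * dy + ny * dx) * B * (b * e)      ∎
    where open ≡-Reasoning

1/[1+2i]≃oddRecip : ∀ i → + 1 ℚ./ suc (2 ℕ.* i) ≃ oddRecip i
1/[1+2i]≃oddRecip i = *≡* (subst (λ z → ↥ (+ 1 ℚ./ suc (2 ℕ.* i)) * z ≡ + 1 * ↧ (+ 1 ℚ./ suc (2 ℕ.* i)))
  (sym (2*i+1≡+[1+2*i] i)) (↥/↧-cross (+ 1) (suc (2 ℕ.* i))))

oddHarmonic≃oddHarmonic′ : ∀ n → oddHarmonic n ≃ oddHarmonic′ n
oddHarmonic≃oddHarmonic′ zero    = *≡* refl
oddHarmonic≃oddHarmonic′ (suc n) = ≃-+ (oddHarmonic≃oddHarmonic′ n) (1/[1+2i]≃oddRecip n)

coprime-↥↧ : ∀ r → Coprime ∣ ↥ r ∣ (↧ₙ r)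
coprime-↥↧ (mkℚ _ _ n⊥d) = Coprimality.recompute n⊥d

v2-≃ : ∀ {r x} j → r ≃ x → (∃ λ a → num x ≡ a * + (2 ℕ.^ j) × Odd a) → v2 r ≡ + j
v2-≃ {r} {x} j (*≡* r≃x) (a , num-x≡ , odd 2∤a) = begin
  + v2ℕ ∣ ↥ r ∣ - + v2ℕ (↧ₙ r) ≡⟨ cong₂ (λ m n → + m - + n) (proj₁ v2s) (proj₂ v2s) ⟩
  + j - + 0                     ≡⟨ ℤₚ.+-identityʳ (+ j) ⟩
  + j                           ∎
  where
  open ≡-Reasoning
  ∣↥r∣∣den∣≡ : ∣ ↥ r ∣ ℕ.* ∣ den x ∣ ≡ ∣ a ∣ ℕ.* 2 ℕ.^ j ℕ.* ↧ₙ r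
  ∣↥r∣∣den∣≡ = begin
    ∣ ↥ r ∣ ℕ.* ∣ den x ∣                  ≡⟨ ℤₚ.abs-* (↥ r) (den x) ⟨
    ∣ ↥ r * den x ∣                        ≡⟨ cong ∣_∣ (trans r≃x (cong (_* ↧ r) num-x≡)) ⟩
    ∣ a * + (2 ℕ.^ j) * ↧ r ∣              ≡⟨ ℤₚ.abs-* (a * + (2 ℕ.^ j)) (↧ r) ⟩
    ∣ a * + (2 ℕ.^ j) ∣ ℕ.* ↧ₙ r           ≡⟨ cong (ℕ._* ↧ₙ r) (ℤₚ.abs-* a (+ (2 ℕ.^ j))) ⟩
    ∣ a ∣ ℕ.* 2 ℕ.^ j ℕ.* ↧ₙ r             ∎
  v2s : v2ℕ ∣ ↥ r ∣ ≡ j × v2ℕ (↧ₙ r) ≡ 0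
  v2s = v2ℕ-reduced-fraction (coprime-↥↧ r) ∣↥r∣∣den∣≡ (Odd.2∤∣a∣ (den-odd x)) 2∤a

odd-neg : ∀ {a} → Odd a → Odd (- a)
odd-neg {a} (odd 2∤a) = odd (subst (λ n → ¬ 2 ∣ n) (sym (ℤₚ.∣-i∣≡∣i∣ a)) 2∤a)

num-oddHarmonic′ : ∀ k {m} → ¬ 2 ∣ m →
  ∃ λ a → num (oddHarmonic′ (2 ℕ.^ k ℕ.* m)) ≡ a * + (2 ℕ.^ (k ℕ.+ k)) × Odd a
num-oddHarmonic′ k {m} 2∤m = num-≡-odd*2^ (k ℕ.+ k) (oddHarmonic′ d) (- (+ m * + m))
  (subst₂ (λ c n → oddHarmonic′ d ≡ ι c [mod2^ n ]) -d²≡ (ℕₚ.+-suc k k) (oddHarmonic′≡-d² k (m∣m*n m)))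
  (odd-neg (odd-* (odd {+ m} 2∤m) (odd {+ m} 2∤m)))
  where
  d : ℕ
  d = 2 ℕ.^ k ℕ.* m
  identity : ∀ P M → - (P * M * (P * M)) ≡ - (M * M) * (P * P)
  identity = solve-∀
  -d²≡ : - (+ d * + d) ≡ - (+ m * + m) * + (2 ℕ.^ (k ℕ.+ k))
  -d²≡ = begin
    - (+ d * + d)                                       ≡⟨ cong (λ D → - (D * D)) (ℤₚ.pos-* (2 ℕ.^ k) m) ⟩
    - (+ (2 ℕ.^ k) * + m * (+ (2 ℕ.^ k) * + m))         ≡⟨ identity (+ (2 ℕ.^ k)) (+ m) ⟩
    - (+ m * + m) * (+ (2 ℕ.^ k) * + (2 ℕ.^ k))         ≡⟨ cong (- (+ m * + m) *_) (pos-2^-distrib-+ k k) ⟨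
    - (+ m * + m) * + (2 ℕ.^ (k ℕ.+ k))                 ∎
    where open ≡-Reasoning

v2-oddHarmonic : ∀ k {m} → ¬ 2 ∣ m → v2 (oddHarmonic (2 ℕ.^ k ℕ.* m)) ≡ + (k ℕ.+ k)
v2-oddHarmonic k {m} 2∤m = v2-≃ (k ℕ.+ k) (oddHarmonic≃oddHarmonic′ (2 ℕ.^ k ℕ.* m)) (num-oddHarmonic′ k 2∤m)

lemmaC1 : ∀ (d : ℕ) → v2 (oddHarmonic (suc d)) ≡ + (2 Data.Nat.* v2ℕ (suc d))
lemmaC1 d = from-decomposition (suc≡2^k*odd d)
  where
  -- Deliberately not a with-abstraction: normalising this goal unfolds v2ℕ and ℚ normal forms.
  from-decomposition : (∃₂ λ k m → suc d ≡ 2 ℕ.^ k ℕ.* m × ¬ 2 ∣ m) →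
                       v2 (oddHarmonic (suc d)) ≡ + (2 ℕ.* v2ℕ (suc d))
  from-decomposition (k , m , d+1≡2^k*m , 2∤m) = begin
    v2 (oddHarmonic (suc d))         ≡⟨ cong (v2 ∘ oddHarmonic) d+1≡2^k*m ⟩
    v2 (oddHarmonic (2 ℕ.^ k ℕ.* m)) ≡⟨ v2-oddHarmonic k 2∤m ⟩
    + (k ℕ.+ k)                      ≡⟨ cong (λ n → + (k ℕ.+ n)) (ℕₚ.+-identityʳ k) ⟨
    + (2 ℕ.* k)                      ≡⟨ cong (λ n → + (2 ℕ.* n)) (trans (cong v2ℕ d+1≡2^k*m) (v2ℕ-2^k*m k 2∤m)) ⟨
    + (2 ℕ.* v2ℕ (suc d))            ∎
    where open ≡-Reasoning
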